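{- For any graph $G$ with no isolated vertex, order $n$ and maximum degree $\Delta$, $$\left\lceil\frac{2n+\gamma_t(G)}{\Delta+1}\right\rceil\le\gamma_{(2,2,1)}(G)\le\min\{3\gamma(G),\,2\gamma_t(G)\}.$$ Furthermore, if $G$ has minimum degree $\delta\ge2$, then $\gamma_{(2,2,1)}(G)\le\gamma_{\times2,t}(G)$.
   Context: All graphs are finite and simple; $N(v)$ is the open neighbourhood and $f(S)=\sum_{u\in S}f(u)$. $\gamma_{(2,2,1)}(G)$ is the minimum of $\sum_v f(v)$ over functions $f:V(G)\to\{0,1,2\}$ such that $f(N(v))\ge2$ whenever $f(v)\in\{0,1\}$ and $f(N(v))\ge1$ whenever $f(v)=2$. $\gamma(G)$ is the domination number; $\gamma_t(G)$ is the total domination number (minimum size of a set $D$ such that every vertex has a neighbour in $D$); $\gamma_{\times2,t}(G)$ is the double total domination number (minimum size of a set $D$ such that every vertex has at least two neighbours in $D$). -}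

module Defs where

open import Data.Nat using (ℕ; zero; suc; _+_; _*_; _≤_; _⊔_)
open import Data.Nat.DivMod using (_/_)
open import Data.Fin using (Fin; toℕ) renaming (zero to fz; suc to fs)
open import Data.Bool using (Bool; true; false; if_then_else_)
open import Data.Product using (_×_; Σ)
open import Relation.Binary.PropositionalEquality using (_≡_)

∑ : {n : ℕ} → (Fin n → ℕ) → ℕ
∑ {zero}  f = 0
∑ {suc n} f = f fz + ∑ (λ i → f (fs i))

⨆ : {n : ℕ} → (Fin n → ℕ) → ℕ
⨆ {zero}  f = 0
⨆ {suc n} f = f fz ⊔ ⨆ (λ i → f (fs i))

record Graph (n : ℕ) : Set where
  field
    adj   : Fin n → Fin n → Bool
    sym   : ∀ u v → adj u v ≡ adj v u
    irref : ∀ v → adj v v ≡ false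
open Graph public

module _ {n : ℕ} (G : Graph n) where

  nbrsIn : (Fin n → Bool) → Fin n → ℕ
  nbrsIn S v = ∑ (λ u → if adj G v u then (if S u then 1 else 0) else 0)

  degree : Fin n → ℕ
  degree v = nbrsIn (λ _ → true) v

  maxDegree : ℕ
  maxDegree = ⨆ degree

  NoIsolated : Set
  NoIsolated = ∀ v → 1 ≤ degree v

  MinDegreeAtLeast2 : Set
  MinDegreeAtLeast2 = ∀ v → 2 ≤ degree v

  card : (Fin n → Bool) → ℕ
  card S = ∑ (λ v → if S v then 1 else 0)

  fN : (Fin n → Fin 3) → Fin n → ℕ
  fN f v = ∑ (λ u → if adj G v u then toℕ (f u) else 0)

  weight : (Fin n → Fin 3) → ℕ
  weight f = ∑ (λ v → toℕ (f v))

  Is221DF : (Fin n → Fin 3) → Set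
  Is221DF f = ∀ v → (toℕ (f v) ≤ 1 → 2 ≤ fN f v) × (toℕ (f v) ≡ 2 → 1 ≤ fN f v)

  IsDomSet : (Fin n → Bool) → Set
  IsDomSet D = ∀ v → D v ≡ false → 1 ≤ nbrsIn D v

  IsTotalDomSet : (Fin n → Bool) → Set
  IsTotalDomSet D = ∀ v → 1 ≤ nbrsIn D v

  IsDoubleTotalDomSet : (Fin n → Bool) → Set
  IsDoubleTotalDomSet D = ∀ v → 2 ≤ nbrsIn D v

  IsGamma221 : ℕ → Set
  IsGamma221 k = Σ (Fin n → Fin 3) (λ f → Is221DF f × weight f ≡ k)
               × (∀ f → Is221DF f → k ≤ weight f)

  IsMinSize : ((Fin n → Bool) → Set) → ℕ → Set
  IsMinSize P k = Σ (Fin n → Bool) (λ D → P D × card D ≡ k)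
                × (∀ D → P D → k ≤ card D)

  IsGamma : ℕ → Set
  IsGamma = IsMinSize IsDomSet

  IsGammaT : ℕ → Set
  IsGammaT = IsMinSize IsTotalDomSet

  IsGammaX2T : ℕ → Set
  IsGammaX2T = IsMinSize IsDoubleTotalDomSet

⌈_/suc_⌉ : ℕ → ℕ → ℕ
⌈ a /suc d ⌉ = (a + d) / suc d

-- A (2,2,1)-dominating function f makes its support S a total dominating set, and
-- at every vertex f(N(v)) + f(v) ≥ 2 + [v ∈ S]. Summing over v and double counting
-- ∑ f(N(v)) = ∑ f(u) deg(u) ≤ Δ·w(f) gives (Δ + 1)·w(f) ≥ 2n + |S| ≥ 2n + γt.
-- For the upper bounds: 2 on a total dominating set and 1 on a double total
-- dominating set are (2,2,1)-dominating; from a dominating set D, put 2 on D and 1 on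
-- one chosen neighbour of each vertex of D that lies outside D.
module Submission where

open import Defs renaming (sym to adj-sym)
open import Data.Nat using (ℕ; zero; suc; _+_; _*_; _≤_; _⊓_; z≤n; s≤s; s≤s⁻¹)
open import Data.Nat.Properties hiding (_≟_)
open import Data.Nat.DivMod using (m<n*o⇒m/o<n)
open import Data.Product using (_×_; _,_; Σ; proj₁; proj₂)
open import Data.Fin using (Fin; toℕ; _≟_) renaming (zero to fz; suc to fs)
open import Data.Bool using (Bool; true; false; if_then_else_)
open import Relation.Nullary using (does)
open import Relation.Nullary.Decidable using (dec-true)
open import Relation.Binary.PropositionalEquality
open import Algebra.Properties.CommutativeSemigroup +-commutativeSemigroup using (interchange)

ind : Bool → ℕ
ind b = if b then 1 else 0

1≤ind⇒true : ∀ {b} → 1 ≤ ind b → b ≡ true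
1≤ind⇒true {true} _ = refl

if-0≡*ind : ∀ b x → (if b then x else 0) ≡ x * ind b
if-0≡*ind true  x = sym (*-identityʳ x)
if-0≡*ind false x = sym (*-zeroʳ x)

∑-cong : ∀ {n} {f g : Fin n → ℕ} → (∀ i → f i ≡ g i) → ∑ f ≡ ∑ g
∑-cong {zero}  eq = refl
∑-cong {suc n} eq = cong₂ _+_ (eq fz) (∑-cong (λ i → eq (fs i)))

∑-mono : ∀ {n} {f g : Fin n → ℕ} → (∀ i → f i ≤ g i) → ∑ f ≤ ∑ g
∑-mono {zero}  le = z≤n
∑-mono {suc n} le = +-mono-≤ (le fz) (∑-mono (λ i → le (fs i)))

∑-const : ∀ {n} c → ∑ {n} (λ _ → c) ≡ c * n
∑-const {zero}  c = sym (*-zeroʳ c)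
∑-const {suc n} c = trans (cong (c +_) (∑-const {n} c)) (sym (*-suc c n))

∑-zero : ∀ {n} → ∑ {n} (λ _ → 0) ≡ 0
∑-zero {n} = ∑-const {n} 0

∑-+ : ∀ {n} (f g : Fin n → ℕ) → ∑ (λ i → f i + g i) ≡ ∑ f + ∑ g
∑-+ {zero}  f g = refl
∑-+ {suc n} f g = trans (cong (f fz + g fz +_) (∑-+ (λ i → f (fs i)) (λ i → g (fs i))))
                        (interchange (f fz) (g fz) _ _)

∑-*ˡ : ∀ {n} c (f : Fin n → ℕ) → ∑ (λ i → c * f i) ≡ c * ∑ f
∑-*ˡ {zero}  c f = sym (*-zeroʳ c)
∑-*ˡ {suc n} c f = trans (cong (c * f fz +_) (∑-*ˡ c (λ i → f (fs i))))
                         (sym (*-distribˡ-+ c (f fz) _))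

∑-*ʳ : ∀ {n} c (f : Fin n → ℕ) → ∑ (λ i → f i * c) ≡ ∑ f * c
∑-*ʳ c f = trans (∑-cong (λ i → *-comm (f i) c)) (trans (∑-*ˡ c f) (*-comm c (∑ f)))

∑-comm : ∀ {m n} (f : Fin m → Fin n → ℕ) →
         ∑ (λ i → ∑ (λ j → f i j)) ≡ ∑ (λ j → ∑ (λ i → f i j))
∑-comm {zero}  {n} f = sym (∑-zero {n})
∑-comm {suc m} f = trans (cong (∑ (f fz) +_) (∑-comm (λ i → f (fs i))))
                         (sym (∑-+ (f fz) (λ j → ∑ (λ i → f (fs i) j))))

≤-∑ : ∀ {n} (f : Fin n → ℕ) i → f i ≤ ∑ f
≤-∑ f fz     = m≤m+n _ _
≤-∑ f (fs i) = ≤-trans (≤-∑ (λ j → f (fs j)) i) (m≤n+m _ _)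

∑-pos⇒∃ : ∀ {n} (f : Fin n → ℕ) → 1 ≤ ∑ f → Σ (Fin n) (λ i → 1 ≤ f i)
∑-pos⇒∃ {suc n} f pos with f fz in eq
... | suc _ = fz , subst (1 ≤_) (sym eq) (s≤s z≤n)
... | zero  with i , fi≥1 ← ∑-pos⇒∃ (λ i → f (fs i)) pos = fs i , fi≥1

≤-⨆ : ∀ {n} (f : Fin n → ℕ) i → f i ≤ ⨆ f
≤-⨆ f fz     = m≤m⊔n _ _
≤-⨆ f (fs i) = ≤-trans (≤-⨆ (λ j → f (fs j)) i) (m≤n⊔m _ _)

∑-indicator : ∀ {n} (q : Fin n) → ∑ (λ u → ind (does (q ≟ u))) ≡ 1
∑-indicator {suc n} fz     = cong suc (∑-zero {n})
∑-indicator         (fs q) = ∑-indicator q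

⌈/suc⌉≤ : ∀ {a d w} → a ≤ w * suc d → ⌈ a /suc d ⌉ ≤ w
⌈/suc⌉≤ {a} {d} {w} a≤ = s≤s⁻¹ (m<n*o⇒m/o<n {a + d} {suc w} {suc d} (begin-strict
  a + d           ≤⟨ +-monoˡ-≤ d a≤ ⟩
  w * suc d + d   <⟨ +-monoʳ-< (w * suc d) (n<1+n d) ⟩
  w * suc d + suc d ≡⟨ +-comm (w * suc d) (suc d) ⟩
  suc w * suc d   ∎))
  where open ≤-Reasoning

two one : Fin 3
one = fs fz
two = fs (fs fz)

support : Fin 3 → Bool
support fz     = false
support (fs _) = true

toℕ≤2*support : ∀ x → toℕ x ≤ 2 * ind (support x)
toℕ≤2*support fz           = z≤n
toℕ≤2*support (fs fz)      = s≤s z≤n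
toℕ≤2*support (fs (fs fz)) = ≤-refl

-- Is221DF G f unfolds at v to Local221 (f v) (fN G f v).
Local221 : Fin 3 → ℕ → Set
Local221 x k = (toℕ x ≤ 1 → 2 ≤ k) × (toℕ x ≡ 2 → 1 ≤ k)

2≤⇒Local221 : ∀ {x k} → 2 ≤ k → Local221 x k
2≤⇒Local221 2≤k = (λ _ → 2≤k) , (λ _ → ≤-trans (n≤1+n 1) 2≤k)

Local221⇒1≤ : ∀ x {k} → Local221 x k → 1 ≤ k
Local221⇒1≤ fz           (low , _)  = ≤-trans (n≤1+n 1) (low z≤n)
Local221⇒1≤ (fs fz)      (low , _)  = ≤-trans (n≤1+n 1) (low (s≤s z≤n))
Local221⇒1≤ (fs (fs fz)) (_ , high) = high refl

Local221⇒2+support≤ : ∀ x {k} → Local221 x k → 2 + ind (support x) ≤ k + toℕ x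
Local221⇒2+support≤ fz           (low , _)  = +-monoˡ-≤ 0 (low z≤n)
Local221⇒2+support≤ (fs fz)      (low , _)  = +-monoˡ-≤ 1 (low (s≤s z≤n))
Local221⇒2+support≤ (fs (fs fz)) (_ , high) = +-monoˡ-≤ 2 (high refl)

atMostOne : ℕ → Fin 3
atMostOne zero    = fz
atMostOne (suc _) = one

scale : ∀ {n} → Fin 3 → (Fin n → Bool) → Fin n → Fin 3
scale x T u = if T u then x else fz

toℕ-scale : ∀ {n} x (T : Fin n → Bool) u → toℕ (scale x T u) ≡ toℕ x * ind (T u)
toℕ-scale x T u with T u
... | true  = sym (*-identityʳ (toℕ x))
... | false = sym (*-zeroʳ (toℕ x))

module _ {n : ℕ} (G : Graph n) where

  -- fN G f and nbrsIn G S are definitionally nbrSum (toℕ ∘ f) and nbrSum (ind ∘ S).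
  nbrSum : (Fin n → ℕ) → Fin n → ℕ
  nbrSum h v = ∑ (λ u → if adj G v u then h u else 0)

  nbrSum-cong : ∀ {h k} → (∀ u → h u ≡ k u) → ∀ v → nbrSum h v ≡ nbrSum k v
  nbrSum-cong eq v = ∑-cong (λ u → cong (λ m → if adj G v u then m else 0) (eq u))

  nbrSum-mono : ∀ {h k} → (∀ u → h u ≤ k u) → ∀ v → nbrSum h v ≤ nbrSum k v
  nbrSum-mono le v = ∑-mono (λ u → if-mono (adj G v u) (le u))
    where
    if-mono : ∀ b {x y} → x ≤ y → (if b then x else 0) ≤ (if b then y else 0)
    if-mono true  x≤y = x≤y
    if-mono false _   = z≤n

  nbrSum-*ˡ : ∀ c h v → nbrSum (λ u → c * h u) v ≡ c * nbrSum h v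
  nbrSum-*ˡ c h v = trans (∑-cong (λ u → *-if (adj G v u))) (∑-*ˡ c (λ u → if adj G v u then h u else 0))
    where
    *-if : ∀ b {x} → (if b then c * x else 0) ≡ c * (if b then x else 0)
    *-if true  = refl
    *-if false = sym (*-zeroʳ c)

  ∑-nbrSum : ∀ h → ∑ (nbrSum h) ≡ ∑ (λ u → h u * degree G u)
  ∑-nbrSum h = begin
    ∑ (λ v → ∑ (λ u → if adj G v u then h u else 0)) ≡⟨ ∑-comm (λ v u → if adj G v u then h u else 0) ⟩
    ∑ (λ u → ∑ (λ v → if adj G v u then h u else 0)) ≡⟨ ∑-cong (λ u → ∑-cong (λ v → adj-swap u v)) ⟩
    ∑ (λ u → ∑ (λ v → h u * ind (adj G u v)))        ≡⟨ ∑-cong (λ u → ∑-*ˡ (h u) (λ v → ind (adj G u v))) ⟩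
    ∑ (λ u → h u * degree G u)                       ∎
    where
    open ≡-Reasoning
    adj-swap : ∀ u v → (if adj G v u then h u else 0) ≡ h u * ind (adj G u v)
    adj-swap u v = trans (cong (λ b → if b then h u else 0) (adj-sym G v u)) (if-0≡*ind _ (h u))

  ∑-nbrSum≤ : ∀ h → ∑ (nbrSum h) ≤ ∑ h * maxDegree G
  ∑-nbrSum≤ h = begin
    ∑ (nbrSum h)                      ≡⟨ ∑-nbrSum h ⟩
    ∑ (λ u → h u * degree G u)        ≤⟨ ∑-mono (λ u → *-monoʳ-≤ (h u) (≤-⨆ (degree G) u)) ⟩
    ∑ (λ u → h u * maxDegree G)       ≡⟨ ∑-*ʳ (maxDegree G) h ⟩
    ∑ h * maxDegree G                 ∎
    where open ≤-Reasoning

  support-isTotalDomSet : ∀ {f} → Is221DF G f → IsTotalDomSet G (λ u → support (f u))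
  support-isTotalDomSet {f} df v = 1≤2*m⇒1≤m (begin
    1                                          ≤⟨ Local221⇒1≤ (f v) (df v) ⟩
    fN G f v                                   ≤⟨ nbrSum-mono (λ u → toℕ≤2*support (f u)) v ⟩
    nbrSum (λ u → 2 * ind (support (f u))) v   ≡⟨ nbrSum-*ˡ 2 (λ u → ind (support (f u))) v ⟩
    2 * nbrsIn G (λ u → support (f u)) v       ∎)
    where
    open ≤-Reasoning
    1≤2*m⇒1≤m : ∀ {m} → 1 ≤ 2 * m → 1 ≤ m
    1≤2*m⇒1≤m {suc _} _ = s≤s z≤n

  weight-lowerBound : ∀ {f gt} → Is221DF G f → IsGammaT G gt →
                      2 * n + gt ≤ weight G f * suc (maxDegree G)
  weight-lowerBound {f} {gt} df (_ , γt-min) = begin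
    2 * n + gt                       ≤⟨ +-monoʳ-≤ (2 * n) (γt-min S (support-isTotalDomSet df)) ⟩
    2 * n + card G S                 ≡⟨ cong (_+ card G S) (sym (∑-const {n} 2)) ⟩
    ∑ {n} (λ _ → 2) + card G S       ≡⟨ sym (∑-+ (λ _ → 2) (λ v → ind (S v))) ⟩
    ∑ (λ v → 2 + ind (S v))          ≤⟨ ∑-mono (λ v → Local221⇒2+support≤ (f v) (df v)) ⟩
    ∑ (λ v → fN G f v + toℕ (f v))   ≡⟨ ∑-+ (fN G f) (λ v → toℕ (f v)) ⟩
    ∑ (fN G f) + w                   ≤⟨ +-monoˡ-≤ w (∑-nbrSum≤ (λ v → toℕ (f v))) ⟩
    w * Δ + w                        ≡⟨ +-comm (w * Δ) w ⟩
    w + w * Δ                        ≡⟨ sym (*-suc w Δ) ⟩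
    w * suc Δ                        ∎
    where
    open ≤-Reasoning
    S = λ u → support (f u)
    w = weight G f
    Δ = maxDegree G

  weight-scale : ∀ x T → weight G (scale x T) ≡ toℕ x * card G T
  weight-scale x T = trans (∑-cong (toℕ-scale x T)) (∑-*ˡ (toℕ x) (λ u → ind (T u)))

  fN-scale : ∀ x T v → fN G (scale x T) v ≡ toℕ x * nbrsIn G T v
  fN-scale x T v = trans (nbrSum-cong (toℕ-scale x T) v) (nbrSum-*ˡ (toℕ x) (λ u → ind (T u)) v)

  scale-Is221DF : ∀ x T → (∀ v → 2 ≤ toℕ x * nbrsIn G T v) → Is221DF G (scale x T)
  scale-Is221DF x T 2≤ v = 2≤⇒Local221 (subst (2 ≤_) (sym (fN-scale x T v)) (2≤ v))

  module _ (noIsolated : NoIsolated G) where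

    neighbour : Fin n → Fin n
    neighbour v = proj₁ (∑-pos⇒∃ (λ u → ind (adj G v u)) (noIsolated v))

    adj-neighbour : ∀ v → adj G v (neighbour v) ≡ true
    adj-neighbour v = 1≤ind⇒true (proj₂ (∑-pos⇒∃ (λ u → ind (adj G v u)) (noIsolated v)))

    module _ (D : Fin n → Bool) where

      pointsTo : Fin n → Fin n → ℕ
      pointsTo v u = ind (D v) * ind (does (neighbour v ≟ u))

      pointers : Fin n → ℕ
      pointers u = ∑ (λ v → pointsTo v u)

      ∑-pointsTo : ∀ v → ∑ (pointsTo v) ≡ ind (D v)
      ∑-pointsTo v = begin
        ∑ (pointsTo v)                                      ≡⟨ ∑-*ˡ (ind (D v)) (λ u → ind (does (neighbour v ≟ u))) ⟩
        ind (D v) * ∑ (λ u → ind (does (neighbour v ≟ u))) ≡⟨ cong (ind (D v) *_) (∑-indicator (neighbour v)) ⟩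
        ind (D v) * 1                                       ≡⟨ *-identityʳ (ind (D v)) ⟩
        ind (D v)                                           ∎
        where open ≡-Reasoning

      ∑-pointers : ∑ pointers ≡ card G D
      ∑-pointers = trans (sym (∑-comm pointsTo)) (∑-cong ∑-pointsTo)

      1≤pointers-neighbour : ∀ v → D v ≡ true → 1 ≤ pointers (neighbour v)
      1≤pointers-neighbour v Dv = ≤-trans (≤-reflexive (sym pointsTo-self)) (≤-∑ (λ w → pointsTo w (neighbour v)) v)
        where
        pointsTo-self : pointsTo v (neighbour v) ≡ 1
        pointsTo-self rewrite Dv | dec-true (neighbour v ≟ neighbour v) refl = refl

      domDF : Fin n → Fin 3
      domDF u = if D u then two else atMostOne (pointers u)

      toℕ-domDF≤ : ∀ u → toℕ (domDF u) ≤ 2 * ind (D u) + pointers u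
      toℕ-domDF≤ u with D u | pointers u
      ... | true  | k     = m≤m+n 2 k
      ... | false | zero  = z≤n
      ... | false | suc _ = s≤s z≤n

      2*ind≤domDF : ∀ u → 2 * ind (D u) ≤ toℕ (domDF u)
      2*ind≤domDF u with D u
      ... | true  = ≤-refl
      ... | false = z≤n

      1≤domDF : ∀ u → 1 ≤ pointers u → 1 ≤ toℕ (domDF u)
      1≤domDF u pos with D u | pointers u
      ... | true  | _     = s≤s z≤n
      ... | false | suc _ = s≤s z≤n

      weight-domDF : weight G domDF ≤ 3 * card G D
      weight-domDF = begin
        weight G domDF                    ≤⟨ ∑-mono toℕ-domDF≤ ⟩
        ∑ (λ u → 2 * ind (D u) + pointers u) ≡⟨ ∑-+ (λ u → 2 * ind (D u)) pointers ⟩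
        ∑ (λ u → 2 * ind (D u)) + ∑ pointers ≡⟨ cong₂ _+_ (∑-*ˡ 2 (λ u → ind (D u))) ∑-pointers ⟩
        2 * card G D + card G D           ≡⟨ +-comm (2 * card G D) (card G D) ⟩
        3 * card G D                      ∎
        where open ≤-Reasoning

      domDF-Is221DF : IsDomSet G D → Is221DF G domDF
      domDF-Is221DF dom v with D v in Dv
      ... | false = 2≤⇒Local221 2≤fN
        where
        2≤fN : 2 ≤ fN G domDF v
        2≤fN = begin
          2                                   ≤⟨ *-monoʳ-≤ 2 (dom v Dv) ⟩
          2 * nbrsIn G D v                    ≡⟨ nbrSum-*ˡ 2 (λ u → ind (D u)) v ⟨
          nbrSum (λ u → 2 * ind (D u)) v      ≤⟨ nbrSum-mono 2*ind≤domDF v ⟩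
          fN G domDF v                        ∎
          where open ≤-Reasoning
      ... | true = (λ { (s≤s ()) }) , λ _ →
        ≤-trans atNeighbour (≤-∑ (λ u → if adj G v u then toℕ (domDF u) else 0) p)
        where
        p = neighbour v
        atNeighbour : 1 ≤ (if adj G v p then toℕ (domDF p) else 0)
        atNeighbour rewrite adj-neighbour v = 1≤domDF p (1≤pointers-neighbour v Dv)

theorem3p20 : {n : ℕ} (G : Graph n) → NoIsolated G →
    (g221 g gt : ℕ) → IsGamma221 G g221 → IsGamma G g → IsGammaT G gt →
    (⌈ 2 * n + gt /suc maxDegree G ⌉ ≤ g221 × g221 ≤ (3 * g) ⊓ (2 * gt))
    × (MinDegreeAtLeast2 G → (gx : ℕ) → IsGammaX2T G gx → g221 ≤ gx)
theorem3p20 {n} G noIsolated g221 g gt ((f , df , refl) , γ221-min) ((D , dom , refl) , _) γt@((T , total , refl) , _) =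
  (lower , ⊓-glb ≤3γ ≤2γt) , ≤γ×2t
  where
  lower : ⌈ 2 * n + card G T /suc maxDegree G ⌉ ≤ weight G f
  lower = ⌈/suc⌉≤ (weight-lowerBound G df γt)

  ≤3γ : weight G f ≤ 3 * card G D
  ≤3γ = ≤-trans (γ221-min _ (domDF-Is221DF G noIsolated D dom)) (weight-domDF G noIsolated D)

  ≤2γt : weight G f ≤ 2 * card G T
  ≤2γt = ≤-trans (γ221-min _ (scale-Is221DF G two T (λ v → *-monoʳ-≤ 2 (total v))))
                 (≤-reflexive (weight-scale G two T))

  -- δ ≥ 2 only guarantees that a double total dominating set exists.
  ≤γ×2t : MinDegreeAtLeast2 G → (gx : ℕ) → IsGammaX2T G gx → weight G f ≤ gx
  ≤γ×2t _ _ ((E , doubleTotal , refl) , _) =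
    ≤-trans (γ221-min _ (scale-Is221DF G one E (λ v → subst (2 ≤_) (sym (*-identityˡ _)) (doubleTotal v))))
            (≤-reflexive (trans (weight-scale G one E) (*-identityˡ (card G E))))
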